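{- Let $\Gamma$ be a numerical semigroup and let $\mu_\Gamma=\min\{k\in\mathbb{N}: W_\Gamma(k)\ge 0\}$. Then $\mu_\Gamma\le t(\Gamma)+1$.
   Context: A numerical semigroup is an additive submonoid $\Gamma\subseteq\mathbb{N}$ with finite complement, with multiplicity $m=\min(\Gamma\setminus\{0\})$, conductor $c(\Gamma)$ (one more than the largest integer not in $\Gamma$) and delta-invariant $\delta(\Gamma)=|\{x\in\Gamma:x<c(\Gamma)\}|$. The Wilf function is $W_\Gamma(k)=k\delta(\Gamma)-c(\Gamma)$. With $s\preceq t$ iff $t-s\in\Gamma$ and $\mathrm{Ap}(\Gamma,m)=\{w\in\Gamma: w-m\notin\Gamma\}$, the type $t(\Gamma)$ is the number of $\preceq$-maximal elements of $\mathrm{Ap}(\Gamma,m)\setminus\{0\}$. -}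

module Defs where

open import Data.Nat using (ℕ; zero; suc; _+_; _*_; _∸_; _≤_; _<_)
open import Data.Integer as ℤ using (ℤ; +_; _-_)
open import Data.List using (List; length; filter; upTo)
open import Data.List.Membership.Propositional using (_∈_)
open import Data.List.Relation.Unary.Unique.Propositional using (Unique)
open import Data.Product using (Σ; _×_; _,_; ∃)
open import Function.Bundles using (_⇔_)
open import Relation.Nullary using (¬_)
open import Relation.Unary using (Decidable)
open import Relation.Binary.PropositionalEquality using (_≡_)

record NumericalSemigroup : Set₁ where
  field
    _∈Γ     : ℕ → Set
    ∈Γ?     : Decidable _∈Γ
    zero∈   : 0 ∈Γ
    +-closed : ∀ a b → a ∈Γ → b ∈Γ → (a + b) ∈Γ
    cofinite : ∃ λ N → ∀ n → N ≤ n → n ∈Γ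

open NumericalSemigroup public

IsConductor : NumericalSemigroup → ℕ → Set
IsConductor Γ c =
  (∀ n → c ≤ n → _∈Γ Γ n) ×
  (∀ c' → (∀ n → c' ≤ n → _∈Γ Γ n) → c ≤ c')

IsMultiplicity : NumericalSemigroup → ℕ → Set
IsMultiplicity Γ m =
  _∈Γ Γ m × 0 < m × (∀ x → _∈Γ Γ x → 0 < x → m ≤ x)

delta : NumericalSemigroup → ℕ → ℕ
delta Γ c = length (filter (∈Γ? Γ) (upTo c))

Wilf : NumericalSemigroup → ℕ → ℕ → ℤ
Wilf Γ c k = + (k * delta Γ c) - + c

_≼[_]_ : ℕ → NumericalSemigroup → ℕ → Set
s ≼[ Γ ] t = Σ ℕ λ g → _∈Γ Γ g × t ≡ s + g

-- Apéry set Ap(Γ,m) = {w ∈ Γ : w - m ∉ Γ} (w - m ∉ Γ includes the case w < m)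
InApery : NumericalSemigroup → ℕ → ℕ → Set
InApery Γ m w = _∈Γ Γ w × ¬ (Σ ℕ λ v → _∈Γ Γ v × w ≡ v + m)

IsMaximalApery : NumericalSemigroup → ℕ → ℕ → Set
IsMaximalApery Γ m w =
  InApery Γ m w × ¬ (w ≡ 0) ×
  (∀ w' → InApery Γ m w' → ¬ (w' ≡ 0) → w ≼[ Γ ] w' → w' ≡ w)

IsType : NumericalSemigroup → ℕ → ℕ → Set
IsType Γ m t = Σ (List ℕ) λ xs →
  Unique xs × (∀ w → (w ∈ xs) ⇔ IsMaximalApery Γ m w) × length xs ≡ t

IsLeast : (ℕ → Set) → ℕ → Set
IsLeast P μ = P μ × (∀ k → P k → μ ≤ k)

-- For a gap x, take the largest s ∈ Γ with x + s still a gap; then f = x + s is a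
-- pseudo-Frobenius number (f ∉ Γ but f + g ∈ Γ for every nonzero g ∈ Γ), and every
-- such f gives the maximal Apéry element f + m.  Hence each gap is (w − m) − s with
-- w one of the t maximal Apéry elements and s one of the δ elements of Γ below c,
-- so there are at most tδ gaps, c = δ + #gaps ≤ (t + 1)δ, and W(t + 1) ≥ 0.
module Submission where

open import Defs
open import Data.Nat using (ℕ; zero; suc; _+_; _*_; _∸_; _≤_; _<_; z≤n; s≤s; _<?_)
open import Data.Nat.Properties
open import Algebra.Properties.CommutativeSemigroup +-commutativeSemigroup
  using (xy∙z≈xz∙y)
open import Data.Integer using (+_; +≤+) renaming (_≤_ to _≤ℤ_)
open import Data.Integer.Properties using (i≤j⇒0≤j-i)
open import Data.List
  using (List; []; _∷_; _++_; length; map; filter; upTo; cartesianProductWith)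
open import Data.List.Properties
  using (length-++; length-map; length-upTo; length-removeAt′)
open import Data.List.Membership.Propositional using (_∈_)
open import Data.List.Membership.Propositional.Properties
  using (∈-filter⁺; ∈-filter⁻; ∈-upTo⁺; ∈-cartesianProductWith⁺)
open import Data.List.Relation.Unary.Any using (here; there; _─_; index)
open import Data.List.Relation.Unary.All using (lookup)
open import Data.List.Relation.Unary.AllPairs using ([]; _∷_)
open import Data.List.Relation.Unary.Unique.Propositional using (Unique)
open import Data.List.Relation.Unary.Unique.Propositional.Properties
  using (filter⁺; upTo⁺)
open import Data.Product using (Σ; ∃; _×_; _,_)
open import Data.Sum using (inj₁; inj₂)
open import Function using (case_of_)
open import Function.Bundles using (Equivalence)
open import Level using (Level)
open import Relation.Nullary using (¬_; yes; no; contradiction)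
open import Relation.Unary using (Pred; Decidable)
open import Relation.Unary.Properties using (∁?)
open import Relation.Binary.PropositionalEquality
  using (_≡_; _≢_; refl; sym; trans; cong; cong₂; subst; module ≡-Reasoning)

private
  variable
    a ℓ : Level
    A B C : Set a

∈-─ : ∀ {x y : A} {ys} (x∈ys : x ∈ ys) → y ∈ ys → y ≢ x → y ∈ (ys ─ x∈ys)
∈-─ (here refl)  (here refl)  y≢x = contradiction refl y≢x
∈-─ (here refl)  (there y∈ys) _   = y∈ys
∈-─ (there _)    (here y≡z)   _   = here y≡z
∈-─ (there x∈ys) (there y∈ys) y≢x = there (∈-─ x∈ys y∈ys y≢x)

Unique-⊆⇒length≤ : ∀ {xs ys : List A} → Unique xs → (∀ {z} → z ∈ xs → z ∈ ys) →
                   length xs ≤ length ys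
Unique-⊆⇒length≤ {xs = []}     _          _     = z≤n
Unique-⊆⇒length≤ {xs = x ∷ xs} {ys} (x∉xs ∷ u) xs⊆ys =
  subst (suc (length xs) ≤_) (sym (length-removeAt′ ys (index x∈ys)))
    (s≤s (Unique-⊆⇒length≤ u λ z∈xs →
      ∈-─ x∈ys (xs⊆ys (there z∈xs)) λ z≡x → lookup x∉xs z∈xs (sym z≡x)))
  where x∈ys = xs⊆ys (here refl)

length-filter+length-filter-∁ : ∀ {P : Pred A ℓ} (P? : Decidable P) xs →
  length (filter P? xs) + length (filter (∁? P?) xs) ≡ length xs
length-filter+length-filter-∁ P? []       = refl
length-filter+length-filter-∁ P? (x ∷ xs) with P? x
... | yes _ = cong suc (length-filter+length-filter-∁ P? xs)
... | no  _ = trans (+-suc _ _) (cong suc (length-filter+length-filter-∁ P? xs))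

length-cartesianProductWith : ∀ (f : A → B → C) xs ys →
  length (cartesianProductWith f xs ys) ≡ length xs * length ys
length-cartesianProductWith f []       ys = refl
length-cartesianProductWith f (x ∷ xs) ys = begin
  length (map (f x) ys ++ cartesianProductWith f xs ys)
    ≡⟨ length-++ (map (f x) ys) ⟩
  length (map (f x) ys) + length (cartesianProductWith f xs ys)
    ≡⟨ cong₂ _+_ (length-map (f x) ys) (length-cartesianProductWith f xs ys) ⟩
  length ys + length xs * length ys
    ∎
  where open ≡-Reasoning

greatest-≤ : ∀ {P : Pred ℕ ℓ} → Decidable P → P 0 → ∀ n →
             ∃ λ s → P s × (∀ {s'} → s' ≤ n → P s' → s' ≤ s)
greatest-≤ P? p0 zero = 0 , p0 , λ { z≤n _ → z≤n }
greatest-≤ P? p0 (suc n) with P? (suc n) | greatest-≤ P? p0 n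
... | yes p  | _                    = suc n , p , λ s'≤1+n _ → s'≤1+n
... | no  ¬p | s , ps , greatest = s , ps , λ {s'} s'≤1+n ps' →
  case m≤n⇒m<n∨m≡n s'≤1+n of λ where
    (inj₁ s'<1+n) → greatest (≤-pred s'<1+n) ps'
    (inj₂ refl)   → contradiction ps' ¬p

module _ (Γ : NumericalSemigroup) where

  private
    _∈Γ′ : ℕ → Set
    _∈Γ′ = _∈Γ Γ

  IsPseudoFrobenius : ℕ → Set
  IsPseudoFrobenius f = ¬ f ∈Γ′ × (∀ g → g ∈Γ′ → 0 < g → (f + g) ∈Γ′)

  gap<conductor : ∀ {c n} → IsConductor Γ c → ¬ n ∈Γ′ → n < c
  gap<conductor {c} {n} (above-c , _) n∉Γ with n <? c
  ... | yes n<c = n<c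
  ... | no  n≮c = contradiction (above-c n (≮⇒≥ n≮c)) n∉Γ

  pseudoFrobenius+m-isMaximalApery : ∀ {m f} → m ∈Γ′ → 0 < m →
    IsPseudoFrobenius f → IsMaximalApery Γ m (f + m)
  pseudoFrobenius+m-isMaximalApery {m} {f} m∈Γ 0<m (f∉Γ , f+g∈Γ) =
    (f+g∈Γ m m∈Γ 0<m , f+m≢v+m) ,
    (λ f+m≡0 → <⇒≢ (<-≤-trans 0<m (m≤n+m m f)) (sym f+m≡0)) ,
    λ { w' (_ , w'∉Γ+m) _ (g , g∈Γ , w'≡f+m+g) → maximal w' w'∉Γ+m g g∈Γ w'≡f+m+g }
    where
    f+m≢v+m : ¬ (Σ ℕ λ v → v ∈Γ′ × f + m ≡ v + m)
    f+m≢v+m (v , v∈Γ , f+m≡v+m) =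
      f∉Γ (subst _∈Γ′ (sym (+-cancelʳ-≡ m f v f+m≡v+m)) v∈Γ)

    -- above f + m by a nonzero g ∈ Γ lies (f + g) + m with f + g ∈ Γ, outside Ap(Γ, m)
    maximal : ∀ w' → ¬ (Σ ℕ λ v → v ∈Γ′ × w' ≡ v + m) →
              ∀ g → g ∈Γ′ → w' ≡ f + m + g → w' ≡ f + m
    maximal w' _       zero    _   w'≡f+m+0 = trans w'≡f+m+0 (+-identityʳ (f + m))
    maximal w' w'∉Γ+m (suc g) g∈Γ w'≡f+m+g =
      contradiction (f + suc g , f+g∈Γ (suc g) g∈Γ (s≤s z≤n) ,
                     trans w'≡f+m+g (xy∙z≈xz∙y f m (suc g)))
                    w'∉Γ+m

  gap+element-isPseudoFrobenius : ∀ {c x} → IsConductor Γ c → ¬ x ∈Γ′ →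
    ∃ λ s → s ∈Γ′ × s < c × IsPseudoFrobenius (x + s)
  gap+element-isPseudoFrobenius {c} {x} conductor x∉Γ =
    let s , Ps@(s∈Γ , x+s∉Γ) , greatest = greatest-≤ P? P0 c
    in s , s∈Γ , s<c Ps , x+s∉Γ , greatest⇒x+s+g∈Γ Ps greatest
    where
    P : ℕ → Set
    P s = s ∈Γ′ × ¬ (x + s) ∈Γ′

    P? : Decidable P
    P? s with ∈Γ? Γ s | ∈Γ? Γ (x + s)
    ... | yes s∈Γ | no x+s∉Γ  = yes (s∈Γ , x+s∉Γ)
    ... | yes _   | yes x+s∈Γ = no λ (_ , x+s∉Γ) → x+s∉Γ x+s∈Γ
    ... | no s∉Γ  | _         = no λ (s∈Γ , _) → s∉Γ s∈Γ

    P0 : P 0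
    P0 = zero∈ Γ , subst (λ n → ¬ n ∈Γ′) (sym (+-identityʳ x)) x∉Γ

    s<c : ∀ {s} → P s → s < c
    s<c {s} (_ , x+s∉Γ) = ≤-<-trans (m≤n+m s x) (gap<conductor conductor x+s∉Γ)

    greatest⇒x+s+g∈Γ : ∀ {s} → P s → (∀ {s'} → s' ≤ c → P s' → s' ≤ s) →
                       ∀ g → g ∈Γ′ → 0 < g → (x + s + g) ∈Γ′
    greatest⇒x+s+g∈Γ {s} (s∈Γ , _) greatest g g∈Γ 0<g with ∈Γ? Γ (x + s + g)
    ... | yes x+s+g∈Γ = x+s+g∈Γ
    ... | no  x+s+g∉Γ =
      contradiction (greatest (<⇒≤ (s<c Ps+g)) Ps+g) (<⇒≱ (m<m+n s 0<g))
      where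
      Ps+g : P (s + g)
      Ps+g = +-closed Γ s g s∈Γ g∈Γ , subst (λ n → ¬ n ∈Γ′) (+-assoc x s g) x+s+g∉Γ

  elementsBelow gapsBelow : ℕ → List ℕ
  elementsBelow c = filter (∈Γ? Γ) (upTo c)
  gapsBelow     c = filter (∁? (∈Γ? Γ)) (upTo c)

  gap≡maximalApery∸m∸element : ∀ {c m x} → IsConductor Γ c → m ∈Γ′ → 0 < m →
    ¬ x ∈Γ′ → ∃ λ w → ∃ λ s → IsMaximalApery Γ m w × s ∈ elementsBelow c × x ≡ w ∸ m ∸ s
  gap≡maximalApery∸m∸element {c} {m} {x} conductor m∈Γ 0<m x∉Γ =
    let s , s∈Γ , s<c , x+s-pseudoFrobenius = gap+element-isPseudoFrobenius conductor x∉Γ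
    in x + s + m , s ,
       pseudoFrobenius+m-isMaximalApery m∈Γ 0<m x+s-pseudoFrobenius ,
       ∈-filter⁺ (∈Γ? Γ) (∈-upTo⁺ s<c) s∈Γ ,
       sym (trans (cong (_∸ s) (m+n∸n≡m (x + s) m)) (m+n∸n≡m x s))

  length-gapsBelow≤type*delta : ∀ {c m t} → IsConductor Γ c → IsMultiplicity Γ m →
    IsType Γ m t → length (gapsBelow c) ≤ t * delta Γ c
  length-gapsBelow≤type*delta {c} {m} {t} conductor (m∈Γ , 0<m , _)
                              (ws , _ , ws↔maximal , ∣ws∣≡t) = begin
    length (gapsBelow c)
      ≤⟨ Unique-⊆⇒length≤ (filter⁺ _ (upTo⁺ c)) gaps⊆differences ⟩
    length differences
      ≡⟨ length-cartesianProductWith _ ws (elementsBelow c) ⟩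
    length ws * delta Γ c
      ≡⟨ cong (_* delta Γ c) ∣ws∣≡t ⟩
    t * delta Γ c
      ∎
    where
    open ≤-Reasoning

    differences : List ℕ
    differences = cartesianProductWith (λ w s → w ∸ m ∸ s) ws (elementsBelow c)

    gaps⊆differences : ∀ {x} → x ∈ gapsBelow c → x ∈ differences
    gaps⊆differences x∈gaps =
      let _ , x∉Γ = ∈-filter⁻ (∁? (∈Γ? Γ)) {xs = upTo c} x∈gaps
          w , s , w-maximal , s∈elements , x≡w∸m∸s =
            gap≡maximalApery∸m∸element conductor m∈Γ 0<m x∉Γ
          w∈ws = Equivalence.from (ws↔maximal w) w-maximal
      in subst (_∈ differences) (sym x≡w∸m∸s)
           (∈-cartesianProductWith⁺ _ w∈ws s∈elements)

  conductor≤[1+type]*delta : ∀ {c m t} → IsConductor Γ c → IsMultiplicity Γ m →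
    IsType Γ m t → c ≤ suc t * delta Γ c
  conductor≤[1+type]*delta {c} {t = t} conductor multiplicity type = begin
    c
      ≡⟨ sym (length-upTo c) ⟩
    length (upTo c)
      ≡⟨ sym (length-filter+length-filter-∁ (∈Γ? Γ) (upTo c)) ⟩
    delta Γ c + length (gapsBelow c)
      ≤⟨ +-monoʳ-≤ (delta Γ c) (length-gapsBelow≤type*delta conductor multiplicity type) ⟩
    delta Γ c + t * delta Γ c
      ∎
    where open ≤-Reasoning

proposition3p7 : (Γ : NumericalSemigroup) (c m t μ : ℕ) →
    IsConductor Γ c → IsMultiplicity Γ m → IsType Γ m t →
    IsLeast (λ k → + 0 ≤ℤ Wilf Γ c k) μ →
    μ ≤ suc t
proposition3p7 Γ c m t μ conductor multiplicity type (_ , least) =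
  least (suc t) (i≤j⇒0≤j-i (+≤+ (conductor≤[1+type]*delta Γ conductor multiplicity type)))
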